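{- Let $(U,\varphi)$ be a finite standard closure space whose lattice of closed sets is modular. Let $C$ be a non-join-irreducible essential set with predecessors $C_1,\dots,C_m$, and let $C_*=C_1\cap\dots\cap C_m$. Then $x$ is almost prime in $(\downarrow C,\subseteq)$ if and only if there exists a unique $i$ with $C_i\setminus C_*=\{x\}$.
   Context: $(U,\varphi)$: finite set with closure operator; closed sets $\mathcal{C}$ form a lattice under inclusion; standard: $\varphi(\{x\})\setminus\{x\}$ closed for all $x$. Predecessor of $C$: closed $C'\subsetneq C$ with no closed set strictly between; join-irreducible: exactly one predecessor. Quasi-closed $Q$: for all $X\subseteq Q$ with $\varphi(X)\subsetneq\varphi(Q)$, $\varphi(X)\subseteq Q$; pseudo-closed $P$: not closed and inclusion-minimal among quasi-closed $Q$ with $\varphi(Q)=\varphi(P)$; essential: $\varphi(P)$ for $P$ pseudo-closed. $\downarrow C=\{C'\in\mathcal{C}:C'\subseteq C\}$; $x$ is prime in $(\downarrow C,\subseteq)$ if for all $C',C''\in\downarrow C$, $x\in\varphi(C'\cup C'')$ implies $x\in C'$ or $x\in C''$. For $x\in C$, $x$ is almost prime in $(\downarrow C,\subseteq)$ if $x$ is not prime in $(\downarrow C,\subseteq)$ but is prime in $(\downarrow C',\subseteq)$ for every predecessor $C'$ of $C$ with $x\in C'$. -}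

module Defs where

open import Data.Nat using (ℕ)
open import Data.Fin using (Fin)
open import Data.Fin.Subset public
  using (Subset; _∈_; _∉_; _⊆_; _⊂_; _∪_; _∩_; _─_; ⁅_⁆)
open import Data.Product using (Σ; ∃; _×_; _,_)
open import Data.Sum using (_⊎_)
open import Relation.Nullary using (¬_)
open import Relation.Binary.PropositionalEquality using (_≡_)

record ClosureSpace (n : ℕ) : Set where
  field
    φ          : Subset n → Subset n
    extensive  : ∀ X → X ⊆ φ X
    monotone   : ∀ {X Y} → X ⊆ Y → φ X ⊆ φ Y
    idempotent : ∀ X → φ (φ X) ≡ φ X

module _ {n : ℕ} (S : ClosureSpace n) where
  open ClosureSpace S

  Closed : Subset n → Set
  Closed X = φ X ≡ X

  Standard : Set
  Standard = ∀ (x : Fin n) → Closed (φ ⁅ x ⁆ ─ ⁅ x ⁆)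

  -- modularity of the lattice of closed sets (meet = ∩, join = φ(A ∪ B)):
  -- for closed A, B, D with A ⊆ D:  A ∨ (B ∧ D) = (A ∨ B) ∧ D
  Modular : Set
  Modular = ∀ A B D → Closed A → Closed B → Closed D → A ⊆ D →
            φ (A ∪ (B ∩ D)) ≡ φ (A ∪ B) ∩ D

  Predecessor : Subset n → Subset n → Set
  Predecessor C' C = Closed C' × C' ⊂ C ×
    (∀ D → Closed D → C' ⊆ D → D ⊆ C → D ≡ C' ⊎ D ≡ C)

  JoinIrreducible : Subset n → Set
  JoinIrreducible C = Σ (Subset n) λ P → Predecessor P C ×
    (∀ Q → Predecessor Q C → Q ≡ P)

  QuasiClosed : Subset n → Set
  QuasiClosed Q = ∀ X → X ⊆ Q → φ X ⊂ φ Q → φ X ⊆ Q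

  PseudoClosed : Subset n → Set
  PseudoClosed P = ¬ Closed P × QuasiClosed P ×
    (∀ Q → QuasiClosed Q → φ Q ≡ φ P → Q ⊆ P → Q ≡ P)

  Essential : Subset n → Set
  Essential C = Σ (Subset n) λ P → PseudoClosed P × φ P ≡ C

  Prime : Fin n → Subset n → Set
  Prime x C = ∀ C₁ C₂ → Closed C₁ → Closed C₂ → C₁ ⊆ C → C₂ ⊆ C →
    x ∈ φ (C₁ ∪ C₂) → x ∈ C₁ ⊎ x ∈ C₂

  AlmostPrime : Fin n → Subset n → Set
  AlmostPrime x C = x ∈ C × ¬ Prime x C ×
    (∀ C' → Predecessor C' C → x ∈ C' → Prime x C')

  _∈Star_ : Fin n → Subset n → Set
  y ∈Star C = ∀ P → Predecessor P C → y ∈ P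

  DiffStarSingleton : Subset n → Subset n → Fin n → Set
  DiffStarSingleton C' C x =
    ∀ y → ((y ∈ C' × ¬ (y ∈Star C)) → y ≡ x) × (y ≡ x → (y ∈ C' × ¬ (y ∈Star C)))

{-# OPTIONS --safe #-}
module Submission where

-- Modularity makes R ∩ T ⋖ T or R ∩ T = T for every predecessor R of C and closed T ⊆ C, and
-- standardness makes a cover M ⋖ T whose missing point x is prime in ↓T add nothing but x.
-- (⇒) If x is almost prime, a witness of its non-primality in ↓C extends to two predecessors
-- Ca ⊈ Cb avoiding x, and some predecessor Ci contains x. Then Ci ∖ {x} lies in every predecessor
-- avoiding x; for a predecessor R ∋ x the cover R ∩ Ca ⋖ Ca forces Ca ∩ Cb ⊆ R, so Ci ∖ {x} ⊆ C_*.
-- (⇐) If Ci ∖ C_* = {x}, every predecessor containing x is Ci, and x is prime there since the rest of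
-- Ci lies in the closed set C_*. If x were also prime in ↓C, then C = P ∪ {x} for a predecessor P ∌ x,
-- and modularity would make the pseudo-closed set generating C closed.

open import Defs
open import Data.Nat using (ℕ)
open import Data.Bool.Properties using () renaming (_≟_ to _≟ᵇ_)
open import Data.Vec using (_∷_; here; there)
open import Data.Vec.Properties using (≡-dec)
open import Data.Fin using (Fin; zero; _≟_)
open import Data.Fin.Properties using (any?)
open import Data.Fin.Subset using (inside; outside; _-_)
open import Data.Fin.Subset.Properties
  using (_∈?_; _⊆?_; anySubset?; ⊆-refl; ⊆-reflexive; ⊆-trans; ⊆-antisym; ∪-comm;
         p∩q⊆p; p∩q⊆q; x∈p∩q⁺; x∈p∩q⁻; p⊆p∪q; q⊆p∪q; x∈p∪q⁻;
         x∈⁅x⁆; x∈⁅y⁆⇒x≡y; p─q⊆p; x∈p∧x≢y⇒x∈p-y)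
open import Data.List using ([]; _∷_; allFin)
open import Data.List.Relation.Unary.All as All using (All; []; _∷_)
open import Data.List.Membership.Propositional.Properties using (∈-allFin)
open import Data.Product using (Σ; ∃; ∃₂; _×_; _,_; proj₁; proj₂)
open import Data.Sum using (_⊎_; inj₁; inj₂; [_,_]′)
open import Data.Empty using (⊥; ⊥-elim)
open import Function using (_∘_; id)
open import Function.Bundles using (_⇔_; mk⇔)
open import Relation.Nullary using (¬_; Dec; yes; no; contradiction)
open import Relation.Nullary.Decidable using (decidable-stable; _×-dec_; ¬?)
open import Relation.Binary.PropositionalEquality using (_≡_; _≢_; refl; sym; subst)

x∈p─q⇒x∉q : ∀ {n} (p q : Subset n) {x} → x ∈ p ─ q → x ∉ q
x∈p─q⇒x∉q (inside ∷ p)  (outside ∷ q)         here          ()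
x∈p─q⇒x∉q (inside ∷ p)  (inside ∷ q)  {zero}  ()
x∈p─q⇒x∉q (outside ∷ p) (outside ∷ q) {zero}  ()
x∈p─q⇒x∉q (outside ∷ p) (inside ∷ q)  {zero}  ()
x∈p─q⇒x∉q (_ ∷ p)       (_ ∷ q)               (there x∈p─q) (there x∈q) = x∈p─q⇒x∉q p q x∈p─q x∈q

module _ {n : ℕ} where

  x∉p-x : ∀ (p : Subset n) x → x ∉ p - x
  x∉p-x p x x∈p-x = x∈p─q⇒x∉q p ⁅ x ⁆ x∈p-x (x∈⁅x⁆ x)

  ∪-lub : ∀ {p q r : Subset n} → p ⊆ r → q ⊆ r → p ∪ q ⊆ r
  ∪-lub {p} {q} p⊆r q⊆r x∈p∪q = [ p⊆r , q⊆r ]′ (x∈p∪q⁻ p q x∈p∪q)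

  ⁅x⁆⊆p : ∀ {x} {p : Subset n} → x ∈ p → ⁅ x ⁆ ⊆ p
  ⁅x⁆⊆p {x} {p} x∈p y∈⁅x⁆ = subst (_∈ p) (sym (x∈⁅y⁆⇒x≡y x y∈⁅x⁆)) x∈p

  ⊈⇒∃∉ : ∀ {p q : Subset n} → ¬ p ⊆ q → ∃ λ x → x ∈ p × x ∉ q
  ⊈⇒∃∉ {p} {q} p⊈q = decidable-stable (any? λ x → (x ∈? p) ×-dec ¬? (x ∈? q)) λ ∄ →
    p⊈q λ {x} x∈p → decidable-stable (x ∈? q) λ x∉q → ∄ (x , x∈p , x∉q)

module _ {n : ℕ} (S : ClosureSpace n) where
  open ClosureSpace S

  private variable
    x y z : Fin n
    A B C D M P Q R T Y Ci Ca Cb : Subset n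

  φ-closed : ∀ X → Closed S (φ X)
  φ-closed = idempotent

  φ-least : Closed S D → A ⊆ D → φ A ⊆ D
  φ-least D-closed A⊆D = ⊆-trans (monotone A⊆D) (⊆-reflexive D-closed)

  closed-intro : φ A ⊆ A → Closed S A
  closed-intro φA⊆A = ⊆-antisym φA⊆A (extensive _)

  closed? : ∀ A → Dec (Closed S A)
  closed? A = ≡-dec _≟ᵇ_ (φ A) A

  ∩-closed : Closed S A → Closed S B → Closed S (A ∩ B)
  ∩-closed {A} {B} A-closed B-closed = closed-intro λ z∈φ →
    x∈p∩q⁺ (φ-least A-closed (p∩q⊆p A B) z∈φ , φ-least B-closed (p∩q⊆q A B) z∈φ)

  x∈φ⁅x⁆ : ∀ x → x ∈ φ ⁅ x ⁆
  x∈φ⁅x⁆ x = extensive _ (x∈⁅x⁆ x)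

  φ⁅x⁆⊆ : Closed S D → x ∈ D → φ ⁅ x ⁆ ⊆ D
  φ⁅x⁆⊆ D-closed x∈D = φ-least D-closed (⁅x⁆⊆p x∈D)

  essential⇒closed : Essential S C → Closed S C
  essential⇒closed (Q , _ , refl) = φ-closed Q

  quasiClosed-∩-closed : QuasiClosed S Q → Closed S D → ¬ φ Q ⊆ D → Closed S (Q ∩ D)
  quasiClosed-∩-closed {Q} {D} Q-qc D-closed φQ⊈D =
    closed-intro λ z∈φ → x∈p∩q⁺ (φQ∩D⊆Q z∈φ , φ-least D-closed (p∩q⊆q Q D) z∈φ)
    where
    φQ∩D⊂φQ : φ (Q ∩ D) ⊂ φ Q
    φQ∩D⊂φQ = let w , w∈φQ , w∉D = ⊈⇒∃∉ φQ⊈D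
              in monotone (p∩q⊆p Q D) , w , w∈φQ , w∉D ∘ φ-least D-closed (p∩q⊆q Q D)
    φQ∩D⊆Q : φ (Q ∩ D) ⊆ Q
    φQ∩D⊆Q = Q-qc (Q ∩ D) (p∩q⊆p Q D) φQ∩D⊂φQ

  NoClosedBetween : Subset n → Subset n → Set
  NoClosedBetween M T = ∀ E → Closed S E → M ⊆ E → E ⊆ T → E ≡ M ⊎ E ≡ T

  cover-join : Closed S T → NoClosedBetween M T → M ⊆ T → Y ⊆ T → Y ⊆ M ⊎ T ⊆ φ (Y ∪ M)
  cover-join {T} {M} {Y} T-closed M⋖T M⊆T Y⊆T
    with M⋖T (φ (Y ∪ M)) (φ-closed _) (⊆-trans (q⊆p∪q Y M) (extensive _)) (φ-least T-closed (∪-lub Y⊆T M⊆T))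
  ... | inj₁ φY∪M≡M = inj₁ (⊆-trans (⊆-trans (p⊆p∪q M) (extensive _)) (⊆-reflexive φY∪M≡M))
  ... | inj₂ φY∪M≡T = inj₂ (⊆-reflexive (sym φY∪M≡T))

  cover-generated : Closed S T → NoClosedBetween M T → M ⊆ T → z ∈ T → z ∉ M → T ⊆ φ (φ ⁅ z ⁆ ∪ M)
  cover-generated {z = z} T-closed M⋖T M⊆T z∈T z∉M =
    [ (λ φ⁅z⁆⊆M → ⊥-elim (z∉M (φ⁅z⁆⊆M (x∈φ⁅x⁆ z)))) , id ]′ (cover-join T-closed M⋖T M⊆T (φ⁅x⁆⊆ T-closed z∈T))

  predecessor-closed : Predecessor S P C → Closed S P
  predecessor-closed (P-closed , _ , _) = P-closed

  predecessor-⊆ : Predecessor S P C → P ⊆ C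
  predecessor-⊆ (_ , (P⊆C , _) , _) = P⊆C

  predecessor-⊉ : Predecessor S P C → ¬ C ⊆ P
  predecessor-⊉ (_ , (_ , z , z∈C , z∉P) , _) C⊆P = z∉P (C⊆P z∈C)

  predecessor-cover : Predecessor S P C → NoClosedBetween P C
  predecessor-cover (_ , _ , P⋖C) = P⋖C

  predecessor-⊆⇒≡ : Predecessor S P C → Predecessor S R C → P ⊆ R → P ≡ R
  predecessor-⊆⇒≡ P≺C R≺C P⊆R with predecessor-cover P≺C _ (predecessor-closed R≺C) P⊆R (predecessor-⊆ R≺C)
  ... | inj₁ R≡P = sym R≡P
  ... | inj₂ R≡C = ⊥-elim (predecessor-⊉ R≺C (⊆-reflexive (sym R≡C)))

  module _ (C-closed : Closed S C) where

    ProperClosed : Subset n → Set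
    ProperClosed M = Closed S M × M ⊆ C × ¬ C ⊆ M

    Blocks : Subset n → Fin n → Set
    Blocks M y = y ∈ C → y ∈ M ⊎ C ⊆ φ (M ∪ ⁅ y ⁆)

    blocks-mono : M ⊆ R → Blocks M y → Blocks R y
    blocks-mono {M} {R} {y} M⊆R M-blocks y∈C = [ inj₁ ∘ M⊆R , inj₂ ∘ grow ]′ (M-blocks y∈C)
      where
      grow : C ⊆ φ (M ∪ ⁅ y ⁆) → C ⊆ φ (R ∪ ⁅ y ⁆)
      grow C⊆ = ⊆-trans C⊆ (monotone (∪-lub (⊆-trans M⊆R (p⊆p∪q ⁅ y ⁆)) (q⊆p∪q R ⁅ y ⁆)))

    absorb : ∀ y → ProperClosed M → ∃ λ R → ProperClosed R × M ⊆ R × Blocks R y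
    absorb {M} y M-proper@(M-closed , M⊆C , C⊈M) with y ∈? C | C ⊆? φ (M ∪ ⁅ y ⁆)
    ... | no y∉C  | _       = M , M-proper , ⊆-refl , λ y∈C → contradiction y∈C y∉C
    ... | yes _   | yes C⊆  = M , M-proper , ⊆-refl , λ _ → inj₂ C⊆
    ... | yes y∈C | no C⊈  =
      φ (M ∪ ⁅ y ⁆) , (φ-closed _ , φ-least C-closed (∪-lub M⊆C (⁅x⁆⊆p y∈C)) , C⊈)
      , ⊆-trans (p⊆p∪q ⁅ y ⁆) (extensive _) , λ _ → inj₁ (extensive _ (q⊆p∪q M ⁅ y ⁆ (x∈⁅x⁆ y)))

    saturate : ∀ ys → ProperClosed M → ∃ λ R → ProperClosed R × M ⊆ R × All (Blocks R) ys
    saturate {M} [] M-proper = M , M-proper , ⊆-refl , []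
    saturate (y ∷ ys) M-proper =
      let R₁ , R₁-proper , M⊆R₁ , R₁-blocks = absorb y M-proper
          R , R-proper , R₁⊆R , R-blocks = saturate ys R₁-proper
      in R , R-proper , ⊆-trans M⊆R₁ R₁⊆R , blocks-mono R₁⊆R R₁-blocks ∷ R-blocks

    blocked⇒predecessor : ProperClosed M → (∀ y → Blocks M y) → Predecessor S M C
    blocked⇒predecessor {M} (M-closed , M⊆C , C⊈M) blocked = M-closed , (M⊆C , ⊈⇒∃∉ C⊈M) , M⋖C
      where
      M⋖C : NoClosedBetween M C
      M⋖C E E-closed M⊆E E⊆C with E ⊆? M
      ... | yes E⊆M = inj₁ (⊆-antisym E⊆M M⊆E)
      ... | no E⊈M with ⊈⇒∃∉ E⊈M
      ... | y , y∈E , y∉M with blocked y (E⊆C y∈E)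
      ... | inj₁ y∈M = contradiction y∈M y∉M
      ... | inj₂ C⊆φM∪y = inj₂ (⊆-antisym E⊆C (⊆-trans C⊆φM∪y (φ-least E-closed (∪-lub M⊆E (⁅x⁆⊆p y∈E)))))

    extend-to-predecessor : Closed S D → D ⊆ C → ¬ C ⊆ D → ∃ λ P → Predecessor S P C × D ⊆ P
    extend-to-predecessor D-closed D⊆C C⊈D =
      let P , P-proper , D⊆P , P-blocks = saturate (allFin n) (D-closed , D⊆C , C⊈D)
      in P , blocked⇒predecessor P-proper (λ y → All.lookup P-blocks (∈-allFin y)) , D⊆P

  module _ (standard : Standard S) where

    φ⁅x⁆-joinIrreducible : ∀ x → JoinIrreducible S (φ ⁅ x ⁆)
    φ⁅x⁆-joinIrreducible x = φ ⁅ x ⁆ - x , W≺φ⁅x⁆ , λ Q Q≺φ⁅x⁆ → predecessor-⊆⇒≡ Q≺φ⁅x⁆ W≺φ⁅x⁆ (Q⊆W Q≺φ⁅x⁆)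
      where
      W≺φ⁅x⁆ : Predecessor S (φ ⁅ x ⁆ - x) (φ ⁅ x ⁆)
      W≺φ⁅x⁆ = standard x , (p─q⊆p _ _ , x , x∈φ⁅x⁆ x , x∉p-x _ x) , W⋖φ⁅x⁆
        where
        W⋖φ⁅x⁆ : NoClosedBetween (φ ⁅ x ⁆ - x) (φ ⁅ x ⁆)
        W⋖φ⁅x⁆ D D-closed W⊆D D⊆φ⁅x⁆ with x ∈? D
        ... | yes x∈D = inj₂ (⊆-antisym D⊆φ⁅x⁆ (φ⁅x⁆⊆ D-closed x∈D))
        ... | no x∉D  = inj₁ (⊆-antisym (λ y∈D → x∈p∧x≢y⇒x∈p-y (D⊆φ⁅x⁆ y∈D) λ { refl → x∉D y∈D }) W⊆D)
      Q⊆W : Predecessor S Q (φ ⁅ x ⁆) → Q ⊆ φ ⁅ x ⁆ - x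
      Q⊆W Q≺φ⁅x⁆ y∈Q = x∈p∧x≢y⇒x∈p-y (predecessor-⊆ Q≺φ⁅x⁆ y∈Q) λ { refl →
        predecessor-⊉ Q≺φ⁅x⁆ (φ⁅x⁆⊆ (predecessor-closed Q≺φ⁅x⁆) y∈Q) }

    ∈-predecessor : Closed S C → ¬ JoinIrreducible S C → z ∈ C → ∃ λ P → Predecessor S P C × z ∈ P
    ∈-predecessor {C} {z} C-closed ¬ji z∈C with C ⊆? φ ⁅ z ⁆
    ... | yes C⊆φ⁅z⁆ = ⊥-elim (¬ji (subst (JoinIrreducible S) (⊆-antisym (φ⁅x⁆⊆ C-closed z∈C) C⊆φ⁅z⁆)
                                            (φ⁅x⁆-joinIrreducible z)))
    ... | no C⊈φ⁅z⁆ =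
      let P , P≺C , φ⁅z⁆⊆P = extend-to-predecessor C-closed (φ-closed _) (φ⁅x⁆⊆ C-closed z∈C) C⊈φ⁅z⁆
      in P , P≺C , φ⁅z⁆⊆P (x∈φ⁅x⁆ z)

  _∈*_ : Fin n → Subset n → Set
  y ∈* C = _∈Star_ S y C

  diffStarSingleton-intro : x ∈ Ci → ¬ x ∈* C → (∀ {y} → y ∈ Ci → y ≢ x → y ∈* C) →
                            DiffStarSingleton S Ci C x
  diffStarSingleton-intro {x} x∈Ci x∉* rest∈* y =
    (λ (y∈Ci , y∉*) → decidable-stable (y ≟ x) λ y≢x → y∉* (rest∈* y∈Ci y≢x)) , λ { refl → x∈Ci , x∉* }

  diffStarSingleton-∈ : DiffStarSingleton S Ci C x → x ∈ Ci
  diffStarSingleton-∈ {x = x} Ci∖C*≡x = proj₁ (proj₂ (Ci∖C*≡x x) refl)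

  diffStarSingleton-∉* : DiffStarSingleton S Ci C x → ¬ x ∈* C
  diffStarSingleton-∉* {x = x} Ci∖C*≡x = proj₂ (proj₂ (Ci∖C*≡x x) refl)

  diffStarSingleton-rest : DiffStarSingleton S Ci C x → y ∈ Ci → y ≢ x → y ∈* C
  diffStarSingleton-rest {y = y} Ci∖C*≡x y∈Ci y≢x R R≺C =
    decidable-stable (y ∈? R) λ y∉R → y≢x (proj₁ (Ci∖C*≡x y) (y∈Ci , λ y∈* → y∉R (y∈* R R≺C)))

  diffStarSingleton-⊆ : DiffStarSingleton S Ci C x → Predecessor S P C → y ∈ Ci → y ∈ P ⊎ y ≡ x
  diffStarSingleton-⊆ {x = x} {y = y} Ci∖C*≡x P≺C y∈Ci with y ≟ x
  ... | yes y≡x = inj₂ y≡x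
  ... | no y≢x  = inj₁ (diffStarSingleton-rest Ci∖C*≡x y∈Ci y≢x _ P≺C)

  diffStarSingleton-∋⇒≡ : Predecessor S Ci C → DiffStarSingleton S Ci C x → Predecessor S P C → x ∈ P → P ≡ Ci
  diffStarSingleton-∋⇒≡ Ci≺C Ci∖C*≡x P≺C x∈P = sym (predecessor-⊆⇒≡ Ci≺C P≺C λ y∈Ci →
    [ id , (λ { refl → x∈P }) ]′ (diffStarSingleton-⊆ Ci∖C*≡x P≺C y∈Ci))

  prime-if-rest∈* : ¬ x ∈* C → (∀ {y} → y ∈ P → y ≢ x → y ∈* C) → Prime S x P
  prime-if-rest∈* {x} {C} {P} x∉* rest∈* A B _ _ A⊆P B⊆P x∈φA∪B with x ∈? A | x ∈? B
  ... | yes x∈A | _       = inj₁ x∈A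
  ... | no _    | yes x∈B = inj₂ x∈B
  ... | no x∉A  | no x∉B  = ⊥-elim (x∉* λ R R≺C →
    φ-least (predecessor-closed R≺C) (∪-lub (⊆R A⊆P x∉A R≺C) (⊆R B⊆P x∉B R≺C)) x∈φA∪B)
    where
    ⊆R : ∀ {X} → X ⊆ P → x ∉ X → Predecessor S R C → X ⊆ R
    ⊆R X⊆P x∉X R≺C y∈X = rest∈* (X⊆P y∈X) (λ { refl → x∉X y∈X }) _ R≺C

  Splits : Fin n → Subset n → Subset n → Set
  Splits x A B = Closed S A × Closed S B × x ∈ φ (A ∪ B) × x ∉ A × x ∉ B

  splits-sym : Splits x A B → Splits x B A
  splits-sym {x} {A} {B} (A-closed , B-closed , x∈φA∪B , x∉A , x∉B) =
    B-closed , A-closed , subst (λ X → x ∈ φ X) (∪-comm A B) x∈φA∪B , x∉B , x∉A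

  ¬prime⇒splits : ¬ Prime S x C → ∃₂ λ A B → A ⊆ C × B ⊆ C × Splits x A B
  ¬prime⇒splits {x} {C} ¬prime = decidable-stable (anySubset? λ A → anySubset? λ B → splits? A B) λ ∄ →
    ¬prime λ A B A-closed B-closed A⊆C B⊆C x∈φA∪B → decide A B λ x∉A x∉B →
      ∄ (A , B , A⊆C , B⊆C , A-closed , B-closed , x∈φA∪B , x∉A , x∉B)
    where
    splits? : ∀ A B → Dec (A ⊆ C × B ⊆ C × Splits x A B)
    splits? A B = A ⊆? C ×-dec B ⊆? C ×-dec closed? A ×-dec closed? B ×-dec
                  x ∈? φ (A ∪ B) ×-dec ¬? (x ∈? A) ×-dec ¬? (x ∈? B)
    decide : ∀ A B → (x ∉ A → x ∉ B → ⊥) → x ∈ A ⊎ x ∈ B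
    decide A B ¬neither with x ∈? A | x ∈? B
    ... | yes x∈A | _       = inj₁ x∈A
    ... | no _    | yes x∈B = inj₂ x∈B
    ... | no x∉A  | no x∉B  = ⊥-elim (¬neither x∉A x∉B)

  module _ (modular : Modular S) where

    ∩-predecessor-cover : Closed S C → Predecessor S R C → Closed S T → T ⊆ C → NoClosedBetween (R ∩ T) T
    ∩-predecessor-cover {C} {R} {T} C-closed R≺C T-closed T⊆C E E-closed R∩T⊆E E⊆T
      with cover-join C-closed (predecessor-cover R≺C) (predecessor-⊆ R≺C) (⊆-trans E⊆T T⊆C)
    ... | inj₁ E⊆R     = inj₁ (⊆-antisym (λ z∈E → x∈p∩q⁺ (E⊆R z∈E , E⊆T z∈E)) R∩T⊆E)
    ... | inj₂ C⊆φE∪R = inj₂ (⊆-antisym E⊆T T⊆E)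
      where
      T⊆E : T ⊆ E
      T⊆E z∈T = φ-least E-closed (∪-lub ⊆-refl R∩T⊆E)
        (subst (_ ∈_) (sym (modular E R T E-closed (predecessor-closed R≺C) T-closed E⊆T))
               (x∈p∩q⁺ (C⊆φE∪R (T⊆C z∈T) , z∈T)))

    ∩-⊆-predecessor : Closed S C → Predecessor S R C → Predecessor S Ca C → Predecessor S Cb C →
                      ¬ Ca ⊆ Cb → R ∩ Ca ⊆ Cb → Ca ∩ Cb ⊆ R
    ∩-⊆-predecessor {R = R} {Ca} {Cb} C-closed R≺C Ca≺C Cb≺C Ca⊈Cb R∩Ca⊆Cb
      with ∩-predecessor-cover C-closed R≺C (predecessor-closed Ca≺C) (predecessor-⊆ Ca≺C) (Ca ∩ Cb)
             (∩-closed (predecessor-closed Ca≺C) (predecessor-closed Cb≺C))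
             (λ z∈R∩Ca → x∈p∩q⁺ (proj₂ (x∈p∩q⁻ R Ca z∈R∩Ca) , R∩Ca⊆Cb z∈R∩Ca)) (p∩q⊆p Ca Cb)
    ... | inj₁ Ca∩Cb≡R∩Ca = ⊆-trans (⊆-reflexive Ca∩Cb≡R∩Ca) (p∩q⊆p R Ca)
    ... | inj₂ Ca∩Cb≡Ca   = ⊥-elim (Ca⊈Cb (⊆-trans (⊆-reflexive (sym Ca∩Cb≡Ca)) (p∩q⊆q Ca Cb)))

    splits⇒¬prime-above : Splits x A B → Closed S P → A ⊆ P → x ∈ P → ¬ Prime S x P
    splits⇒¬prime-above {x} {A} {B} {P} (A-closed , B-closed , x∈φA∪B , x∉A , x∉B) P-closed A⊆P x∈P x-prime =
      [ x∉A , x∉B ∘ proj₁ ∘ x∈p∩q⁻ B P ]′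
        (x-prime A (B ∩ P) A-closed (∩-closed B-closed P-closed) A⊆P (p∩q⊆q B P)
          (subst (x ∈_) (sym (modular A B P A-closed B-closed P-closed A⊆P)) (x∈p∩q⁺ (x∈φA∪B , x∈P))))

    avoiding-predecessor-above : Closed S C → x ∈ C → (∀ P → Predecessor S P C → x ∈ P → Prime S x P) →
                                 Splits x A B → A ⊆ C → ∃ λ P → Predecessor S P C × A ⊆ P × x ∉ P
    avoiding-predecessor-above C-closed x∈C prime-below A,B-split@(A-closed , _ , _ , x∉A , _) A⊆C =
      let P , P≺C , A⊆P = extend-to-predecessor C-closed A-closed A⊆C (λ C⊆A → x∉A (C⊆A x∈C))
      in P , P≺C , A⊆P , λ x∈P →
           splits⇒¬prime-above A,B-split (predecessor-closed P≺C) A⊆P x∈P (prime-below P P≺C x∈P)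

    avoiding-predecessors : Closed S C → x ∈ C → ¬ Prime S x C →
                            (∀ P → Predecessor S P C → x ∈ P → Prime S x P) →
                            ∃₂ λ Ca Cb → Predecessor S Ca C × Predecessor S Cb C × x ∉ Ca × x ∉ Cb × ¬ Ca ⊆ Cb
    avoiding-predecessors C-closed x∈C ¬prime prime-below =
      let A , B , A⊆C , B⊆C , A,B-split = ¬prime⇒splits ¬prime
          _ , _ , x∈φA∪B , _ = A,B-split
          Ca , Ca≺C , A⊆Ca , x∉Ca = avoiding-predecessor-above C-closed x∈C prime-below A,B-split A⊆C
          Cb , Cb≺C , B⊆Cb , x∉Cb = avoiding-predecessor-above C-closed x∈C prime-below (splits-sym A,B-split) B⊆C
      in Ca , Cb , Ca≺C , Cb≺C , x∉Ca , x∉Cb , λ Ca⊆Cb →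
           x∉Cb (φ-least (predecessor-closed Cb≺C) (∪-lub (⊆-trans A⊆Ca Ca⊆Cb) B⊆Cb) x∈φA∪B)

    quasiClosed-point-extension-closed : QuasiClosed S Q → Closed S P → Closed S R → P ⊆ φ Q →
      ¬ φ Q ⊆ P → ¬ φ Q ⊆ R → x ∈ R → (∀ {z} → z ∈ φ Q → z ∈ P ⊎ z ≡ x) → Closed S Q
    quasiClosed-point-extension-closed {Q} {P} {R} {x} Q-qc P-closed R-closed P⊆φQ φQ⊈P φQ⊈R x∈R φQ⊆P+x =
      closed-intro λ z∈φQ → [ P⊆Q , (λ { refl → x∈Q }) ]′ (φQ⊆P+x z∈φQ)
      where
      Q∩P-closed : Closed S (Q ∩ P)
      Q∩P-closed = quasiClosed-∩-closed Q-qc P-closed φQ⊈P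
      Q⊆Q∩P∪Q∩R : Q ⊆ (Q ∩ P) ∪ (Q ∩ R)
      Q⊆Q∩P∪Q∩R z∈Q =
        [ (λ z∈P → p⊆p∪q _ (x∈p∩q⁺ (z∈Q , z∈P))) , (λ { refl → q⊆p∪q _ _ (x∈p∩q⁺ (z∈Q , x∈R)) }) ]′
          (φQ⊆P+x (extensive Q z∈Q))
      Q∩R∩P⊆Q∩P : (Q ∩ R) ∩ P ⊆ Q ∩ P
      Q∩R∩P⊆Q∩P z∈ = let z∈Q∩R , z∈P = x∈p∩q⁻ (Q ∩ R) P z∈ in x∈p∩q⁺ (proj₁ (x∈p∩q⁻ Q R z∈Q∩R) , z∈P)
      P⊆Q : P ⊆ Q
      P⊆Q z∈P = proj₁ (x∈p∩q⁻ Q P (φ-least Q∩P-closed (∪-lub ⊆-refl Q∩R∩P⊆Q∩P)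
        (subst (_ ∈_) (sym (modular (Q ∩ P) (Q ∩ R) P Q∩P-closed (quasiClosed-∩-closed Q-qc R-closed φQ⊈R)
                                    P-closed (p∩q⊆q Q P)))
               (x∈p∩q⁺ (monotone Q⊆Q∩P∪Q∩R (P⊆φQ z∈P) , z∈P)))))
      x∈Q : x ∈ Q
      x∈Q = decidable-stable (x ∈? Q) λ x∉Q → φQ⊈P (φ-least P-closed λ z∈Q →
              [ id , (λ { refl → ⊥-elim (x∉Q z∈Q) }) ]′ (φQ⊆P+x (extensive Q z∈Q)))

    module _ (standard : Standard S) where

      cover-by-prime-point : Closed S T → Prime S x T → x ∈ T →
                             Closed S M → M ⊆ T → NoClosedBetween M T → x ∉ M →
                             y ∈ T → y ≢ x → y ∈ M
      cover-by-prime-point {T} {x} {M} {y} T-closed x-prime x∈T M-closed M⊆T M⋖T x∉M y∈T y≢x =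
        decidable-stable (y ∈? M) λ y∉M → x∉p-x (φ ⁅ y ⁆) y (y∈φ⁅y⁆-y y∉M)
        where
        x∈φ⁅y⁆ : y ∉ M → x ∈ φ ⁅ y ⁆
        x∈φ⁅y⁆ y∉M = [ id , (λ x∈M → ⊥-elim (x∉M x∈M)) ]′
          (x-prime (φ ⁅ y ⁆) M (φ-closed _) M-closed (φ⁅x⁆⊆ T-closed y∈T) M⊆T
                   (cover-generated T-closed M⋖T M⊆T y∈T y∉M x∈T))
        -- φ⁅x⁆ ∨ M = T ∋ y, so modularity puts y into φ⁅x⁆ ∨ (M ∩ φ⁅y⁆) ⊆ φ⁅y⁆ - y.
        y∈φ⁅y⁆-y : y ∉ M → y ∈ φ ⁅ y ⁆ - y
        y∈φ⁅y⁆-y y∉M = φ-least (standard y) (∪-lub φ⁅x⁆⊆φ⁅y⁆-y M∩φ⁅y⁆⊆φ⁅y⁆-y)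
          (subst (y ∈_) (sym (modular (φ ⁅ x ⁆) M (φ ⁅ y ⁆) (φ-closed _) M-closed (φ-closed _)
                                      (φ⁅x⁆⊆ (φ-closed _) (x∈φ⁅y⁆ y∉M))))
                 (x∈p∩q⁺ (cover-generated T-closed M⋖T M⊆T x∈T x∉M y∈T , x∈φ⁅x⁆ y)))
          where
          φ⁅x⁆⊆φ⁅y⁆-y : φ ⁅ x ⁆ ⊆ φ ⁅ y ⁆ - y
          φ⁅x⁆⊆φ⁅y⁆-y = φ⁅x⁆⊆ (standard y) (x∈p∧x≢y⇒x∈p-y (x∈φ⁅y⁆ y∉M) (y≢x ∘ sym))
          M∩φ⁅y⁆⊆φ⁅y⁆-y : M ∩ φ ⁅ y ⁆ ⊆ φ ⁅ y ⁆ - y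
          M∩φ⁅y⁆⊆φ⁅y⁆-y z∈ = let z∈M , z∈φ⁅y⁆ = x∈p∩q⁻ M (φ ⁅ y ⁆) z∈
                             in x∈p∧x≢y⇒x∈p-y z∈φ⁅y⁆ λ { refl → y∉M z∈M }

      predecessor-∖x⊆ : Closed S C → Predecessor S R C → x ∈ R → Prime S x R → Predecessor S P C → x ∉ P →
                        y ∈ R → y ≢ x → y ∈ P
      predecessor-∖x⊆ {R = R} {P = P} C-closed R≺C x∈R x-prime P≺C x∉P y∈R y≢x =
        proj₁ (x∈p∩q⁻ P R (cover-by-prime-point R-closed x-prime x∈R (∩-closed (predecessor-closed P≺C) R-closed)
                 (p∩q⊆q P R) (∩-predecessor-cover C-closed P≺C R-closed (predecessor-⊆ R≺C))
                 (x∉P ∘ proj₁ ∘ x∈p∩q⁻ P R) y∈R y≢x))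
        where
        R-closed : Closed S R
        R-closed = predecessor-closed R≺C

      almostPrime⇒diffStarSingleton : Closed S C → ¬ JoinIrreducible S C → AlmostPrime S x C →
                                      ∃ λ Ci → Predecessor S Ci C × DiffStarSingleton S Ci C x
      almostPrime⇒diffStarSingleton {C} {x} C-closed ¬ji (x∈C , ¬prime , prime-below)
        with ∈-predecessor standard C-closed ¬ji x∈C | avoiding-predecessors C-closed x∈C ¬prime prime-below
      ... | Ci , Ci≺C , x∈Ci | Ca , Cb , Ca≺C , Cb≺C , x∉Ca , x∉Cb , Ca⊈Cb =
        Ci , Ci≺C , diffStarSingleton-intro x∈Ci (λ x∈* → x∉Ca (x∈* Ca Ca≺C)) rest∈*
        where
        avoid : Predecessor S R C → x ∈ R → Predecessor S P C → x ∉ P → y ∈ R → y ≢ x → y ∈ P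
        avoid R≺C x∈R = predecessor-∖x⊆ C-closed R≺C x∈R (prime-below _ R≺C x∈R)
        rest∈* : y ∈ Ci → y ≢ x → y ∈* C
        rest∈* y∈Ci y≢x R R≺C with x ∈? R
        ... | no x∉R  = avoid Ci≺C x∈Ci R≺C x∉R y∈Ci y≢x
        ... | yes x∈R = ∩-⊆-predecessor C-closed R≺C Ca≺C Cb≺C Ca⊈Cb R∩Ca⊆Cb
                          (x∈p∩q⁺ (avoid Ci≺C x∈Ci Ca≺C x∉Ca y∈Ci y≢x , avoid Ci≺C x∈Ci Cb≺C x∉Cb y∈Ci y≢x))
          where
          R∩Ca⊆Cb : R ∩ Ca ⊆ Cb
          R∩Ca⊆Cb z∈R∩Ca = let z∈R , z∈Ca = x∈p∩q⁻ R Ca z∈R∩Ca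
                           in avoid R≺C x∈R Cb≺C x∉Cb z∈R λ { refl → x∉Ca z∈Ca }

      diffStarSingleton⇒almostPrime : Essential S C → ¬ JoinIrreducible S C → Predecessor S Ci C →
                                      DiffStarSingleton S Ci C x → AlmostPrime S x C
      diffStarSingleton⇒almostPrime {C} {Ci} {x} (Q , (Q-open , Q-qc , _) , refl) ¬ji Ci≺C Ci∖C*≡x =
        predecessor-⊆ Ci≺C x∈Ci , ¬prime , prime-below
        where
        x∈Ci : x ∈ Ci
        x∈Ci = diffStarSingleton-∈ Ci∖C*≡x
        prime-below : ∀ P → Predecessor S P C → x ∈ P → Prime S x P
        prime-below P P≺C x∈P = subst (Prime S x) (sym (diffStarSingleton-∋⇒≡ Ci≺C Ci∖C*≡x P≺C x∈P))
          (prime-if-rest∈* (diffStarSingleton-∉* Ci∖C*≡x) (diffStarSingleton-rest Ci∖C*≡x))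
        C⊆P+x : Prime S x C → Predecessor S P C → x ∉ P → z ∈ C → z ∈ P ⊎ z ≡ x
        C⊆P+x x-prime P≺C x∉P z∈C with ∈-predecessor standard (φ-closed Q) ¬ji z∈C
        ... | R , R≺C , z∈R with x ∈? R
        ...   | yes x∈R =
          diffStarSingleton-⊆ Ci∖C*≡x P≺C (subst (_ ∈_) (diffStarSingleton-∋⇒≡ Ci≺C Ci∖C*≡x R≺C x∈R) z∈R)
        ...   | no x∉R with cover-join (φ-closed Q) (predecessor-cover P≺C) (predecessor-⊆ P≺C) (predecessor-⊆ R≺C)
        ...     | inj₁ R⊆P     = inj₁ (R⊆P z∈R)
        ...     | inj₂ C⊆φR∪P = ⊥-elim ([ x∉R , x∉P ]′
          (x-prime _ _ (predecessor-closed R≺C) (predecessor-closed P≺C) (predecessor-⊆ R≺C) (predecessor-⊆ P≺C)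
                   (C⊆φR∪P (predecessor-⊆ Ci≺C x∈Ci))))
        ¬prime : ¬ Prime S x C
        ¬prime x-prime = diffStarSingleton-∉* Ci∖C*≡x λ P P≺C → decidable-stable (x ∈? P) λ x∉P →
          Q-open (quasiClosed-point-extension-closed Q-qc (predecessor-closed P≺C) (predecessor-closed Ci≺C)
                    (predecessor-⊆ P≺C) (predecessor-⊉ P≺C) (predecessor-⊉ Ci≺C) x∈Ci (C⊆P+x x-prime P≺C x∉P))

lemma5 : ∀ {n : ℕ} (S : ClosureSpace n) → Standard S → Modular S →
         ∀ (C : Subset n) → Essential S C → ¬ JoinIrreducible S C →
         ∀ (x : Fin n) →
         AlmostPrime S x C ⇔
           Σ (Subset n) (λ Ci → Predecessor S Ci C × DiffStarSingleton S Ci C x ×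
             (∀ Cj → Predecessor S Cj C → DiffStarSingleton S Cj C x → Cj ≡ Ci))
lemma5 S standard modular C C-essential ¬ji x = mk⇔
  (λ x-almostPrime →
    let Ci , Ci≺C , Ci∖C*≡x = almostPrime⇒diffStarSingleton S modular standard C-closed ¬ji x-almostPrime
    in Ci , Ci≺C , Ci∖C*≡x , λ Cj Cj≺C Cj∖C*≡x →
         diffStarSingleton-∋⇒≡ S Ci≺C Ci∖C*≡x Cj≺C (diffStarSingleton-∈ S Cj∖C*≡x))
  (λ (Ci , Ci≺C , Ci∖C*≡x , _) →
    diffStarSingleton⇒almostPrime S modular standard C-essential ¬ji Ci≺C Ci∖C*≡x)
  where
  C-closed : Closed S C
  C-closed = essential⇒closed S C-essential
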